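{- There exist an absolute constant $c>0$ and strings $T$ (over a three-letter alphabet) with arbitrarily large run-length encoding size $m=R(T)$ such that $|\mathcal{M}_5(T)|\ge c\,m$; i.e. there exist strings $T$ with $R(T)=m$ and $|\mathcal{M}_5(T)|\in\Omega(m)$.
   Context: Here $T$ is a plain string over an alphabet $\Sigma$ (no terminal symbols). For a string $w$, $R(w)$ is the number of maximal runs of equal characters in $w$. A string $w\in\Sigma^*$ is a minimal absent word (MAW) for $T$ if $w$ does not occur in $T$ but every proper substring of $w$ occurs in $T$. Writing a MAW of length $\ge2$ as $aub$ ($a,b\in\Sigma$, $u\in\Sigma^*$), $\mathcal{M}_5(T)$ is the set of MAWs with $R(aub)\ge2$ and ($a=u[1]$ or $b=u[|u|]$). -}

module Defs where

open import Data.Nat using (ℕ; zero; suc; _≤_)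
open import Data.Fin using (Fin)
open import Data.Fin.Properties using (_≟_)
open import Data.List using (List; []; _∷_; _++_; head; last; length)
open import Data.List.Relation.Unary.All using (All)
open import Data.List.Relation.Unary.Unique.Propositional using (Unique)
open import Data.Maybe using (just)
open import Data.Product using (Σ; ∃; _×_; _,_)
open import Data.Sum using (_⊎_)
open import Relation.Nullary using (¬_; yes; no)
open import Relation.Binary.PropositionalEquality using (_≡_)

Σ₃ : Set
Σ₃ = Fin 3

Str : Set
Str = List Σ₃

OccursIn : Str → Str → Set
OccursIn w T = ∃ λ xs → ∃ λ ys → xs ++ w ++ ys ≡ T

runsFrom : Σ₃ → Str → ℕ
runsFrom x []       = 1
runsFrom x (y ∷ ys) with x ≟ y
... | yes _ = runsFrom y ys
... | no  _ = suc (runsFrom y ys)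

R : Str → ℕ
R []       = 0
R (x ∷ xs) = runsFrom x xs

MAW : Str → Str → Set
MAW w T = ¬ OccursIn w T × (∀ v → OccursIn v w → ¬ (v ≡ w) → OccursIn v T)

InM5 : Str → Str → Set
InM5 T w = MAW w T × 2 ≤ R w ×
  (∃ λ (a : Σ₃) → ∃ λ (u : Str) → ∃ λ (b : Σ₃) →
     (w ≡ a ∷ (u ++ b ∷ [])) × (head u ≡ just a ⊎ last u ≡ just b))

M5CardAtLeast : Str → ℕ → Set
M5CardAtLeast T k = ∃ λ (ws : List Str) → Unique ws × All (InM5 T) ws × k ≤ length ws

-- Let T_n be the concatenation of the blocks 0^a 1 0^b with a, b ≥ 1 and
-- a + b = n + 3, each followed by the separator 2; it has 4(n + 2) runs.
-- A factor of T_n avoiding 2 lies inside a single block, so a block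
-- 0^a 1 0^b occurs in T_n only if a + b ≤ n + 3, and it does occur when
-- a, b ≥ 1 and a + b = n + 3.  Hence each of the n + 1 words
-- 0^(i+2) 1 0^(e+2) with i + e = n is absent while its longest proper
-- prefix and suffix occur: it is a minimal absent word, and it lies in M₅
-- because it starts with 00.  So |M₅(T_n)| ≥ n + 1 ≥ R(T_n) / 8.
module Submission where

open import Defs
open import Data.Nat using (ℕ; _≤_; _*_; _<_)
open import Data.Product using (∃; _×_)

open import Data.Nat using (zero; suc; _+_; _∸_; z≤n; s≤s)
open import Data.Nat.Properties
  using (≤-refl; ≤-trans; ≤-reflexive; m≤n⇒m≤1+n; 1+n≰n; <⇒≢; m<1+n⇒m≤n;
         +-suc; +-identityʳ; +-mono-≤; +-monoʳ-≤; m≤m+n; m≤n+m; m+[n∸m]≡n;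
         *-comm; *-identityˡ; *-monoʳ-≤; m≤m*n)
open import Data.Fin.Patterns using (0F; 1F; 2F)
open import Data.Fin.Properties using (_≟_)
open import Data.List using (List; []; _∷_; _++_; [_]; replicate; applyUpTo)
open import Data.List.Properties using (∷-injectiveˡ; ∷-injectiveʳ; ++-assoc; ++-identityʳ; length-applyUpTo)
open import Data.List.Relation.Unary.All using (All; _∷_)
import Data.List.Relation.Unary.All.Properties as All
import Data.List.Relation.Unary.Unique.Propositional.Properties as Unique
open import Data.Product using (_,_)
open import Data.Sum using (_⊎_; inj₁; inj₂) renaming ([_,_] to either)
open import Data.Empty using (⊥-elim)
open import Relation.Nullary using (¬_; yes; no)
open import Relation.Binary.PropositionalEquality
  using (_≡_; _≢_; refl; sym; trans; cong; subst; module ≡-Reasoning)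

private
  variable
    A : Set

OccursIn-++ˡ : ∀ {w t} s → OccursIn w t → OccursIn w (s ++ t)
OccursIn-++ˡ {w} s (xs , ys , eq) = s ++ xs , ys , trans (++-assoc s xs (w ++ ys)) (cong (s ++_) eq)

OccursIn-trans : ∀ {u v w} → OccursIn u v → OccursIn v w → OccursIn u w
OccursIn-trans {u} {v} {w} (xs , ys , u-in-v) (xs′ , ys′ , v-in-w) = xs′ ++ xs , ys ++ ys′ , eq
  where
  open ≡-Reasoning
  eq : (xs′ ++ xs) ++ u ++ ys ++ ys′ ≡ w
  eq = begin
    (xs′ ++ xs) ++ u ++ ys ++ ys′   ≡⟨ ++-assoc xs′ xs (u ++ ys ++ ys′) ⟩
    xs′ ++ xs ++ u ++ ys ++ ys′     ≡⟨ cong (λ z → xs′ ++ xs ++ z) (sym (++-assoc u ys ys′)) ⟩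
    xs′ ++ xs ++ (u ++ ys) ++ ys′   ≡⟨ cong (xs′ ++_) (sym (++-assoc xs (u ++ ys) ys′)) ⟩
    xs′ ++ (xs ++ u ++ ys) ++ ys′   ≡⟨ cong (λ z → xs′ ++ z ++ ys′) u-in-v ⟩
    xs′ ++ v ++ ys′                 ≡⟨ v-in-w ⟩
    w                               ∎

prefix-of-init : ∀ (v : List A) y ys p d → v ++ y ∷ ys ≡ p ++ [ d ] → ∃ λ zs → v ++ zs ≡ p
prefix-of-init []          y ys p        d eq = p , refl
prefix-of-init (_ ∷ [])    y ys []       d ()
prefix-of-init (_ ∷ _ ∷ _) y ys []       d ()
prefix-of-init (x ∷ v)     y ys (_ ∷ p)  d eq with refl ← ∷-injectiveˡ eq
  with zs , v++zs≡p ← prefix-of-init v y ys p d (∷-injectiveʳ eq) = zs , cong (x ∷_) v++zs≡p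

properFactor-in-tail-or-init : ∀ {v} c m d → OccursIn v (c ∷ m ++ [ d ]) → v ≢ c ∷ m ++ [ d ] →
                               OccursIn v (m ++ [ d ]) ⊎ OccursIn v (c ∷ m)
properFactor-in-tail-or-init c m d (_ ∷ xs , ys , eq) _ = inj₁ (xs , ys , ∷-injectiveʳ eq)
properFactor-in-tail-or-init {v} c m d ([] , [] , eq) v≢w = ⊥-elim (v≢w (trans (sym (++-identityʳ v)) eq))
properFactor-in-tail-or-init {v} c m d ([] , y ∷ ys , eq) _
  with zs , v++zs≡cm ← prefix-of-init v y ys (c ∷ m) d eq = inj₂ ([] , zs , v++zs≡cm)

MAW-of-occurring-ends : ∀ {T} c m d → ¬ OccursIn (c ∷ m ++ [ d ]) T →
                        OccursIn (c ∷ m) T → OccursIn (m ++ [ d ]) T → MAW (c ∷ m ++ [ d ]) T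
MAW-of-occurring-ends c m d absent init-occurs tail-occurs =
  absent , λ v v-in-w v≢w →
    either (λ o → OccursIn-trans o tail-occurs) (λ o → OccursIn-trans o init-occurs)
      (properFactor-in-tail-or-init c m d v-in-w v≢w)

prefix-before-separator : ∀ {s} (w : List A) r x y → All (_≢ s) w → w ++ r ≡ x ++ s ∷ y →
                          ∃ λ zs → w ++ zs ≡ x
prefix-before-separator []      r x       y _          eq = x , refl
prefix-before-separator (c ∷ w) r []      y (c≢s ∷ _)  refl = ⊥-elim (c≢s refl)
prefix-before-separator (c ∷ w) r (_ ∷ x) y (_ ∷ w≢s) eq with refl ← ∷-injectiveˡ eq
  with zs , w++zs≡x ← prefix-before-separator w r x y w≢s (∷-injectiveʳ eq) = zs , cong (c ∷_) w++zs≡x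

factor-avoiding-separator : ∀ {s w} x y → All (_≢ s) w → OccursIn w (x ++ s ∷ y) → OccursIn w x ⊎ OccursIn w y
factor-avoiding-separator {w = w} x y w≢s ([] , ys , eq)
  with zs , w++zs≡x ← prefix-before-separator w ys x y w≢s eq = inj₁ ([] , zs , w++zs≡x)
factor-avoiding-separator []      y _   (_ ∷ xs , ys , eq) = inj₂ (xs , ys , ∷-injectiveʳ eq)
factor-avoiding-separator (c ∷ x) y w≢s (_ ∷ xs , ys , eq)
  with factor-avoiding-separator x y w≢s (xs , ys , ∷-injectiveʳ eq)
... | inj₁ o = inj₁ (OccursIn-++ˡ [ c ] o)
... | inj₂ o = inj₂ o

replicate-suc-∷ʳ : ∀ n (x : A) → replicate (suc n) x ≡ replicate n x ++ [ x ]
replicate-suc-∷ʳ zero    x = refl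
replicate-suc-∷ʳ (suc n) x = cong (x ∷_) (replicate-suc-∷ʳ n x)

replicate-++-≤ : ∀ {x : A} b d ys → replicate b x ++ ys ≡ replicate d x → b ≤ d
replicate-++-≤ zero    d       ys eq = z≤n
replicate-++-≤ (suc b) (suc d) ys eq = s≤s (replicate-++-≤ b d ys (∷-injectiveʳ eq))

runsFrom-replicate : ∀ x n ys → runsFrom x (replicate n x ++ ys) ≡ runsFrom x ys
runsFrom-replicate x zero    ys = refl
runsFrom-replicate x (suc n) ys with x ≟ x
... | yes _  = runsFrom-replicate x n ys
... | no x≢x = ⊥-elim (x≢x refl)

block : ℕ → ℕ → Str
block a b = replicate a 0F ++ 1F ∷ replicate b 0F

blocks : ℕ → ℕ → Str
blocks a zero    = []
blocks a (suc b) = block a (suc b) ++ 2F ∷ blocks (suc a) b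

block-suc-∷ʳ : ∀ a b → block a (suc b) ≡ block a b ++ [ 0F ]
block-suc-∷ʳ a b = trans (cong (λ z → replicate a 0F ++ 1F ∷ z) (replicate-suc-∷ʳ b 0F))
                         (sym (++-assoc (replicate a 0F) (1F ∷ replicate b 0F) [ 0F ]))

block-avoids-2 : ∀ a b → All (_≢ 2F) (block a b)
block-avoids-2 a b = All.++⁺ (All.replicate⁺ a (λ ())) ((λ ()) ∷ All.replicate⁺ b (λ ()))

block-++-injective : ∀ a c {b d} {r s : Str} → block a b ++ r ≡ block c d ++ s →
                     a ≡ c × replicate b 0F ++ r ≡ replicate d 0F ++ s
block-++-injective zero    zero    eq = refl , ∷-injectiveʳ eq
block-++-injective (suc a) (suc c) eq with refl , rest ← block-++-injective a c (∷-injectiveʳ eq) = refl , rest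

block-∉-replicate : ∀ {a b} d → ¬ OccursIn (block a b) (replicate d 0F)
block-∉-replicate {zero}  zero    ([] , _ , ())
block-∉-replicate {zero}  (suc d) ([] , _ , ())
block-∉-replicate {suc a} zero    ([] , _ , ())
block-∉-replicate {suc a} (suc d) ([] , ys , eq) = block-∉-replicate {a} d ([] , ys , ∷-injectiveʳ eq)
block-∉-replicate         zero    (_ ∷ _ , _ , ())
block-∉-replicate         (suc d) (_ ∷ xs , ys , eq) = block-∉-replicate d (xs , ys , ∷-injectiveʳ eq)

block-in-block : ∀ {a b} c d → OccursIn (block a b) (block c d) → a ≤ c × b ≤ d
block-in-block {a} {b} c d ([] , ys , eq)
  with refl , rest ← block-++-injective a c (trans eq (sym (++-identityʳ (block c d))))
  = ≤-refl , replicate-++-≤ b d ys (trans rest (++-identityʳ (replicate d 0F)))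
block-in-block zero    d (_ ∷ xs , ys , eq) = ⊥-elim (block-∉-replicate d (xs , ys , ∷-injectiveʳ eq))
block-in-block (suc c) d (_ ∷ xs , ys , eq) with a≤c , b≤d ← block-in-block c d (xs , ys , ∷-injectiveʳ eq)
  = m≤n⇒m≤1+n a≤c , b≤d

block-in-blocks : ∀ {a′ b′} a b → OccursIn (block a′ b′) (blocks a b) → a′ + b′ ≤ a + b
block-in-blocks a zero o = ⊥-elim (block-∉-replicate 0 o)
block-in-blocks {a′} {b′} a (suc b) o
  with factor-avoiding-separator (block a (suc b)) (blocks (suc a) b) (block-avoids-2 a′ b′) o
... | inj₁ o′ with a′≤a , b′≤b ← block-in-block a (suc b) o′ = +-mono-≤ a′≤a b′≤b
... | inj₂ o′ = subst (a′ + b′ ≤_) (sym (+-suc a b)) (block-in-blocks (suc a) b o′)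

block-occurs-in-blocks : ∀ a i e → OccursIn (block (a + i) (suc e)) (blocks a (suc (i + e)))
block-occurs-in-blocks a zero    e =
  subst (λ k → OccursIn (block k (suc e)) (blocks a (suc e))) (sym (+-identityʳ a)) ([] , _ , refl)
block-occurs-in-blocks a (suc i) e =
  subst (λ k → OccursIn (block k (suc e)) (blocks a (suc (suc i + e)))) (sym (+-suc a i))
        (OccursIn-++ˡ (block a (suc (suc i + e))) (OccursIn-++ˡ [ 2F ] (block-occurs-in-blocks (suc a) i e)))

runsFrom-block : ∀ a b c h → runsFrom 0F (block a (suc b) ++ c ∷ h) ≡ 2 + runsFrom 0F (c ∷ h)
runsFrom-block a b c h = begin
  runsFrom 0F (block a (suc b) ++ c ∷ h)                            ≡⟨ cong (runsFrom 0F) (++-assoc (replicate a 0F) _ _) ⟩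
  runsFrom 0F (replicate a 0F ++ 1F ∷ replicate (suc b) 0F ++ c ∷ h) ≡⟨ runsFrom-replicate 0F a _ ⟩
  2 + runsFrom 0F (replicate b 0F ++ c ∷ h)                         ≡⟨ cong (2 +_) (runsFrom-replicate 0F b _) ⟩
  2 + runsFrom 0F (c ∷ h)                                           ∎
  where open ≡-Reasoning

runsFrom-2-blocks : ∀ a b → runsFrom 2F (blocks (suc a) b) ≡ suc (b * 4)
runsFrom-2-blocks a zero    = refl
runsFrom-2-blocks a (suc b) =
  cong suc (trans (runsFrom-block a b 2F _) (cong (3 +_) (runsFrom-2-blocks (suc a) b)))

R-blocks : ∀ a b → R (blocks (suc a) b) ≡ b * 4
R-blocks a zero    = refl
R-blocks a (suc b) = trans (runsFrom-block a b 2F _) (cong (3 +_) (runsFrom-2-blocks (suc a) b))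

text : ℕ → Str
text n = blocks 1 (suc (suc n))

R-text : ∀ n → R (text n) ≡ suc (suc n) * 4
R-text n = R-blocks 0 (suc (suc n))

block-occurs-in-text : ∀ {n} a b → a + b ≡ suc n → OccursIn (block (suc a) (suc b)) (text n)
block-occurs-in-text a b a+b≡1+n =
  subst (λ m → OccursIn (block (suc a) (suc b)) (blocks 1 (suc m))) a+b≡1+n (block-occurs-in-blocks 1 a b)

-- The word 0^(i+2) 1 0^(e+2), written as a u b with a = b = 0.
maw : ℕ → ℕ → Str
maw i e = 0F ∷ block (suc i) (suc e) ++ [ 0F ]

maw≡block : ∀ i e → maw i e ≡ block (suc (suc i)) (suc (suc e))
maw≡block i e = cong (0F ∷_) (sym (block-suc-∷ʳ (suc i) (suc e)))

maw-injectiveˡ : ∀ {i j e e′} → maw i e ≡ maw j e′ → i ≡ j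
maw-injectiveˡ {i} {j} eq with refl , _ ← block-++-injective (suc i) (suc j) (∷-injectiveʳ eq) = refl

R-maw : ∀ i e → R (maw i e) ≡ 3
R-maw i e = runsFrom-block i e 0F []

maw-absent : ∀ {n i e} → i + e ≡ n → ¬ OccursIn (maw i e) (text n)
maw-absent {n} {i} {e} i+e≡n o =
  1+n≰n (subst (_≤ 3 + n) length≡ (block-in-blocks {suc (suc i)} {suc (suc e)} 1 (suc (suc n)) (subst (λ w → OccursIn w (text n)) (maw≡block i e) o)))
  where
  length≡ : suc (suc i) + suc (suc e) ≡ 4 + n
  length≡ = cong (2 +_) (trans (+-suc i (suc e)) (cong suc (trans (+-suc i e) (cong suc i+e≡n))))

maw-∈-M5 : ∀ {n i e} → i + e ≡ n → InM5 (text n) (maw i e)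
maw-∈-M5 {n} {i} {e} i+e≡n =
  MAW-of-occurring-ends 0F u 0F (maw-absent i+e≡n) init-occurs tail-occurs ,
  subst (2 ≤_) (sym (R-maw i e)) (m≤n+m 2 1) ,
  0F , u , 0F , refl , inj₁ refl
  where
  u = block (suc i) (suc e)
  init-occurs : OccursIn (0F ∷ u) (text n)
  init-occurs = block-occurs-in-text (suc i) e (cong suc i+e≡n)
  tail-occurs : OccursIn (u ++ [ 0F ]) (text n)
  tail-occurs = subst (λ w → OccursIn w (text n)) (block-suc-∷ʳ (suc i) (suc e))
                      (block-occurs-in-text i (suc e) (trans (+-suc i e) (cong suc i+e≡n)))

M5-text-card : ∀ n → M5CardAtLeast (text n) (suc n)
M5-text-card n = ws , unique , all-in-M5 , ≤-reflexive (sym (length-applyUpTo maw-summing-to-n (suc n)))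
  where
  maw-summing-to-n : ℕ → Str
  maw-summing-to-n i = maw i (n ∸ i)
  ws = applyUpTo maw-summing-to-n (suc n)
  unique = Unique.applyUpTo⁺₁ maw-summing-to-n (suc n) (λ i<j _ eq → <⇒≢ i<j (maw-injectiveˡ eq))
  all-in-M5 = All.applyUpTo⁺₁ maw-summing-to-n (suc n) (λ i<1+n → maw-∈-M5 (m+[n∸m]≡n (m<1+n⇒m≤n i<1+n)))

lemma12 : ∃ λ (p : ℕ) → ∃ λ (q : ℕ) → 0 < p × 0 < q ×
            (∀ (N : ℕ) → ∃ λ (T : Str) → N ≤ R T ×
               ∃ λ (k : ℕ) → M5CardAtLeast T k × p * R T ≤ q * k)
lemma12 = 1 , 8 , s≤s z≤n , s≤s z≤n , λ n →
  text n , subst (n ≤_) (sym (R-text n)) (≤-trans (m≤n+m n 2) (m≤m*n (suc (suc n)) 4)) ,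
  suc n , M5-text-card n , subst (λ r → 1 * r ≤ 8 * suc n) (sym (R-text n)) (runs≤8[1+n] n)
  where
  runs≤8[1+n] : ∀ n → 1 * (suc (suc n) * 4) ≤ 8 * suc n
  runs≤8[1+n] n = begin
    1 * (suc (suc n) * 4) ≡⟨ *-identityˡ _ ⟩
    8 + n * 4             ≤⟨ +-monoʳ-≤ 8 (*-monoʳ-≤ n (m≤m+n 4 4)) ⟩
    8 + n * 8             ≡⟨ *-comm (suc n) 8 ⟩
    8 * suc n             ∎
    where open Data.Nat.Properties.≤-Reasoning
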